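{- If $P$ is a well partial order with exactly $k$ maximal elements, then $o(P)=\delta+m$ for some limit ordinal $\delta$ (possibly $0$) and some natural number $m\ge k$. Moreover, $k=0$ if and only if $m=0$.
   Context: A well partial order (wpo) is a partial order with no infinite antichain and no infinite strictly decreasing sequence. A linearisation of $P$ is a linear order on the same underlying set that extends the order of $P$. Every linearisation of a wpo is a well order. $o(P)$ denotes the maximal order type of $P$: the largest ordinal that is the order type of a linearisation of $P$ (it exists by the de Jongh–Parikh theorem). -}

module Defs where

open import Data.Nat using (ℕ; suc)
open import Data.Fin using (Fin)
open import Data.Product using (Σ; ∃; _×_)
open import Relation.Nullary using (¬_)
open import Relation.Binary.PropositionalEquality using (_≡_; _≢_)
open import Relation.Binary.Structures using (IsPartialOrder; IsTotalOrder)

module _ {A : Set} (_≤_ : A → A → Set) where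

  _<_ : A → A → Set
  x < y = (x ≤ y) × (x ≢ y)

  -- an infinite antichain: pairwise incomparable distinct terms
  -- (this forces the terms to be pairwise distinct, by reflexivity)
  InfiniteAntichain : (ℕ → A) → Set
  InfiniteAntichain f = ∀ i j → i ≢ j → ¬ (f i ≤ f j)

  StrictlyDecreasing : (ℕ → A) → Set
  StrictlyDecreasing f = ∀ i → f (suc i) < f i

  record IsWPO : Set where
    field
      isPartialOrder  : IsPartialOrder _≡_ _≤_
      noInfAntichain  : ¬ (Σ (ℕ → A) InfiniteAntichain)
      noInfDescending : ¬ (Σ (ℕ → A) StrictlyDecreasing)

  Maximal : A → Set
  Maximal x = ∀ y → x ≤ y → y ≡ x

  record IsLinearisation (_⊑_ : A → A → Set) : Set where
    field
      isTotalOrder : IsTotalOrder _≡_ _⊑_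
      extends      : ∀ x y → x ≤ y → x ⊑ y

HasExactly : {A : Set} → ℕ → (A → Set) → Set
HasExactly {A} n Q =
  Σ (Fin n → A) λ g →
    (∀ i j → g i ≡ g j → i ≡ j) × (∀ i → Q (g i)) × (∀ x → Q x → ∃ λ i → g i ≡ x)

-- order-type comparison of linear orders on A: (A,⊑₁) embeds
-- order-preservingly (strictly monotonically) into (A,⊑₂)
_≼_ : {A : Set} → (A → A → Set) → (A → A → Set) → Set
_≼_ {A} _⊑₁_ _⊑₂_ =
  Σ (A → A) λ f → ∀ x y → x ⊑₁ y → x ≢ y → (f x ⊑₂ f y) × (f x ≢ f y)

-- a linearisation of maximal order type, i.e. of order type o(P)
IsMaxLinearisation : {A : Set} → (A → A → Set) → (A → A → Set) → Set₁
IsMaxLinearisation {A} _≤_ _⊑_ =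
  IsLinearisation _≤_ _⊑_ ×
  (∀ (_⊑'_ : A → A → Set) → IsLinearisation _≤_ _⊑'_ → _⊑'_ ≼ _⊑_)

-- the well order (A,⊑) has order type δ + m with δ a limit ordinal or 0:
-- it has a final segment of exactly m elements (the image of g) and the
-- complementary initial segment (of type δ) has no greatest element.
IsLimitPlus : {A : Set} → (A → A → Set) → ℕ → Set
IsLimitPlus {A} _⊑_ m =
  Σ (Fin m → A) λ g →
    (∀ i j → g i ≡ g j → i ≡ j) ×
    (∀ i y → g i ⊑ y → ∃ λ j → g j ≡ y) ×
    ¬ (Σ A λ x → (∀ i → g i ≢ x) × (∀ y → (∀ i → g i ≢ y) → y ⊑ x))

-- A strictly descending sequence in a linearisation of a wpo would be a bad sequence,
-- so every linearisation is a well order. Removing greatest elements from the top of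
-- the maximal linearisation must stop after finitely many steps; this writes it as
-- δ + m, a final segment of m points above a part δ with no greatest element.
-- A maximal element x of P cannot lie in δ: moving x to the top gives a linearisation
-- of type δ + (m + 1), since δ ∖ {x} ≅ δ by fixing the points below x and sending the
-- others to their successors. An embedding of it into δ + m must send all m + 1 top
-- points into the top m, because no initial segment of a well order embeds below one
-- of its own points. Hence k ≤ m; and if m > 0, the top of the final segment is
-- maximal in P.

{-# OPTIONS --safe #-}
module Submission where

open import Defs
open import Level using (Level; 0ℓ)
open import Axiom.ExcludedMiddle using (ExcludedMiddle)
open import Axiom.DoubleNegationElimination using (em⇒dne)
open import Data.Nat using (ℕ; zero; suc; _≤_; ≤′-refl; ≤′-step)
import Data.Nat as ℕ
open import Data.Nat.Properties using (<⇒<′; <-cmp; <⇒≤; ≤-refl; ≤-trans; n≤0⇒n≡0)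
import Data.Nat.Properties as ℕ
open import Data.Fin using (Fin; zero; suc)
open import Data.Fin.Properties using (injective⇒≤; ¬Fin0)
open import Data.Vec.Functional using ([]; _∷_)
open import Data.Product using (Σ; ∃; _×_; _,_; proj₁; proj₂)
open import Data.Sum using (_⊎_; inj₁; inj₂)
open import Data.Empty using (⊥; ⊥-elim)
open import Function.Base using (_∘_)
open import Function.Bundles using (_⇔_; mk⇔)
open import Relation.Nullary using (¬_; yes; no)
open import Relation.Binary.PropositionalEquality using (_≡_; _≢_; refl; sym; trans; cong; subst; respˡ)
import Relation.Binary.PropositionalEquality as ≡
open import Relation.Binary.Definitions using (Transitive; Total; tri<; tri≈; tri>)
open import Relation.Binary.Structures using (IsPartialOrder; IsTotalOrder)
import Relation.Binary.Construct.NonStrictToStrict as NonStrictToStrict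

dependentChoice : {B : Set} {Q : B → Set} (R : B → B → Set) →
  (∀ {b} → Q b → Σ B λ c → Q c × R b c) → Σ B Q →
  Σ (ℕ → B) λ s → (∀ n → Q (s n)) × (∀ n → R (s n) (s (suc n)))
dependentChoice {B} {Q} R next start =
  proj₁ ∘ walk , proj₂ ∘ walk , λ n → proj₂ (proj₂ (next (proj₂ (walk n))))
  where
  walk : ℕ → Σ B Q
  walk zero = start
  walk (suc n) = proj₁ (next (proj₂ (walk n))) , proj₁ (proj₂ (next (proj₂ (walk n))))

transitive-chain : {B : Set} {R : B → B → Set} → Transitive R → {s : ℕ → B} →
  (∀ n → R (s n) (s (suc n))) → ∀ {i j} → i ℕ.< j → R (s i) (s j)
transitive-chain {R = R} R-trans {s} step {i} i<j = go (<⇒<′ i<j)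
  where
  go : ∀ {j} → i ℕ.<′ j → R (s i) (s j)
  go ≤′-refl = step i
  go (≤′-step i<j) = R-trans (go i<j) (step _)

distinctInImage⇒≤ : {A : Set} {k m : ℕ} {h : Fin k → A} {g : Fin m → A} →
  (∀ i j → h i ≡ h j → i ≡ j) → (∀ i → ∃ λ j → g j ≡ h i) → k ≤ m
distinctInImage⇒≤ {h = h} {g} h-injective h⊆g = injective⇒≤ index-injective
  where
  index-injective : ∀ {i j} → proj₁ (h⊆g i) ≡ proj₁ (h⊆g j) → i ≡ j
  index-injective {i} {j} same = h-injective i j (begin
    h i                  ≡⟨ sym (proj₂ (h⊆g i)) ⟩
    g (proj₁ (h⊆g i))    ≡⟨ cong g same ⟩
    g (proj₁ (h⊆g j))    ≡⟨ proj₂ (h⊆g j) ⟩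
    h j                  ∎)
    where open ≡.≡-Reasoning

moveToTop : {A : Set} → A → (A → A → Set) → A → A → Set
moveToTop x _⊑_ a b = b ≡ x ⊎ (a ≢ x × a ⊑ b)

module _ (em : ExcludedMiddle 0ℓ) {A : Set} where

  strictMono⇒injective : {_⊑₁_ _⊑₂_ : A → A → Set} → Total _⊑₁_ →
    (embedding : _⊑₁_ ≼ _⊑₂_) → ∀ a b → proj₁ embedding a ≡ proj₁ embedding b → a ≡ b
  strictMono⇒injective total (f , f-mono) a b fa≡fb with em {a ≡ b}
  ... | yes a≡b = a≡b
  ... | no a≢b with total a b
  ...   | inj₁ a⊑b = ⊥-elim (proj₂ (f-mono a b a⊑b a≢b) fa≡fb)
  ...   | inj₂ b⊑a = ⊥-elim (proj₂ (f-mono b a b⊑a (a≢b ∘ sym)) (sym fa≡fb))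

  moveToTop-isTotalOrder : {_⊑_ : A → A → Set} → IsTotalOrder _≡_ _⊑_ →
    ∀ x → IsTotalOrder _≡_ (moveToTop x _⊑_)
  moveToTop-isTotalOrder {_⊑_} isTotalOrder x = record
    { isPartialOrder = record
      { isPreorder = record
        { isEquivalence = ≡.isEquivalence ; reflexive = reflexive′ ; trans = trans′ }
      ; antisym = antisym′ }
    ; total = total′ }
    where
    open IsTotalOrder isTotalOrder using (total; antisym) renaming (refl to ⊑-refl; trans to ⊑-trans)
    _⊑′_ : A → A → Set
    _⊑′_ = moveToTop x _⊑_

    reflexive′ : ∀ {a b} → a ≡ b → a ⊑′ b
    reflexive′ {a} refl with em {a ≡ x}
    ... | yes a≡x = inj₁ a≡x
    ... | no a≢x = inj₂ (a≢x , ⊑-refl)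

    trans′ : Transitive _⊑′_
    trans′ _ (inj₁ c≡x) = inj₁ c≡x
    trans′ (inj₁ b≡x) (inj₂ (b≢x , _)) = ⊥-elim (b≢x b≡x)
    trans′ (inj₂ (a≢x , a⊑b)) (inj₂ (_ , b⊑c)) = inj₂ (a≢x , ⊑-trans a⊑b b⊑c)

    antisym′ : ∀ {a b} → a ⊑′ b → b ⊑′ a → a ≡ b
    antisym′ (inj₁ b≡x) (inj₁ a≡x) = trans a≡x (sym b≡x)
    antisym′ (inj₁ b≡x) (inj₂ (b≢x , _)) = ⊥-elim (b≢x b≡x)
    antisym′ (inj₂ (a≢x , _)) (inj₁ a≡x) = ⊥-elim (a≢x a≡x)
    antisym′ (inj₂ (_ , a⊑b)) (inj₂ (_ , b⊑a)) = antisym a⊑b b⊑a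

    total′ : Total _⊑′_
    total′ a b with em {b ≡ x} | em {a ≡ x}
    ... | yes b≡x | _ = inj₁ (inj₁ b≡x)
    ... | no _ | yes a≡x = inj₂ (inj₁ a≡x)
    ... | no b≢x | no a≢x with total a b
    ...   | inj₁ a⊑b = inj₁ (inj₂ (a≢x , a⊑b))
    ...   | inj₂ b⊑a = inj₂ (inj₂ (b≢x , b⊑a))

  moveToTop-isLinearisation : {_≤P_ _⊑_ : A → A → Set} → IsLinearisation _≤P_ _⊑_ →
    ∀ {x} → Maximal _≤P_ x → IsLinearisation _≤P_ (moveToTop x _⊑_)
  moveToTop-isLinearisation {_≤P_} {_⊑_} lin {x} x-maximal = record
    { isTotalOrder = moveToTop-isTotalOrder isTotalOrder x
    ; extends = extends′ }
    where
    open IsLinearisation lin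
    extends′ : ∀ a b → a ≤P b → moveToTop x _⊑_ a b
    extends′ a b a≤Pb with em {b ≡ x}
    ... | yes b≡x = inj₁ b≡x
    ... | no b≢x = inj₂ ((λ { refl → b≢x (x-maximal b a≤Pb) }) , extends a b a≤Pb)

module _ (em : ExcludedMiddle 0ℓ) {A : Set} {_≤P_ : A → A → Set} (wpo : IsWPO _≤P_) where
  open IsWPO wpo
  open IsPartialOrder isPartialOrder using (reflexive)
  private
    dne = em⇒dne em
    _<P_ : A → A → Set
    _<P_ = _<_ _≤P_

  Bad : (ℕ → A) → Set
  Bad f = ∀ {i j} → i ℕ.< j → ¬ (f i ≤P f j)

  private
    module BadSequence {f : ℕ → A} (bad : Bad f) where
      Terminal : ℕ → Set
      Terminal i = ¬ ∃ λ j → i ℕ.< j × f j <P f i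

      descendingSubsequence : ∀ N → (∀ i → N ≤ i → ¬ Terminal i) →
        Σ (ℕ → A) (StrictlyDecreasing _≤P_)
      descendingSubsequence N nonterminal =
        let s , _ , s-step = dependentChoice (λ i j → f j <P f i) next (N , ≤-refl)
        in f ∘ s , s-step
        where
        next : ∀ {i} → N ≤ i → ∃ λ j → N ≤ j × f j <P f i
        next {i} N≤i with j , i<j , fj<fi ← dne (nonterminal i N≤i)
          = j , ≤-trans N≤i (<⇒≤ i<j) , fj<fi

      antichainSubsequence : (∀ N → ∃ λ i → N ≤ i × Terminal i) →
        Σ (ℕ → A) (InfiniteAntichain _≤P_)
      antichainSubsequence terminalAbove =
        let s , s-terminal , s-step = dependentChoice ℕ._<_ next (first (terminalAbove 0))
        in f ∘ s , incomparable s s-terminal s-step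
        where
        first : (∃ λ i → 0 ≤ i × Terminal i) → ∃ Terminal
        first (i , _ , terminal) = i , terminal
        next : ∀ {i} → Terminal i → ∃ λ j → Terminal j × i ℕ.< j
        next {i} _ with j , i<j , terminal ← terminalAbove (suc i) = j , terminal , i<j
        incomparable : ∀ s → (∀ n → Terminal (s n)) → (∀ n → s n ℕ.< s (suc n)) →
          InfiniteAntichain _≤P_ (f ∘ s)
        incomparable s s-terminal s-step a b a≢b fa≤Pfb with <-cmp a b
        ... | tri< a<b _ _ = bad (transitive-chain {R = ℕ._<_} ℕ.<-trans s-step a<b) fa≤Pfb
        ... | tri≈ _ a≡b _ = a≢b a≡b
        ... | tri> _ _ b<a = s-terminal b (s a , sb<sa , fa≤Pfb , λ fa≡fb → bad sb<sa (reflexive (sym fa≡fb)))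
          where
          sb<sa : s b ℕ.< s a
          sb<sa = transitive-chain {R = ℕ._<_} ℕ.<-trans s-step b<a

      impossible : ⊥
      impossible with em {∃ λ N → ∀ i → N ≤ i → ¬ Terminal i}
      ... | yes (N , nonterminal) = noInfDescending (descendingSubsequence N nonterminal)
      ... | no ¬eventuallyNonterminal = noInfAntichain (antichainSubsequence terminalAbove)
        where
        terminalAbove : ∀ N → ∃ λ i → N ≤ i × Terminal i
        terminalAbove N = dne λ none →
          ¬eventuallyNonterminal (N , λ i N≤i terminal → none (i , N≤i , terminal))

  noBadSequence : ∀ f → ¬ Bad f
  noBadSequence f bad = BadSequence.impossible bad

  linearisation-wellFounded : {_⊑_ : A → A → Set} → IsLinearisation _≤P_ _⊑_ →
    ¬ Σ (ℕ → A) (StrictlyDecreasing _⊑_)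
  linearisation-wellFounded {_⊑_} lin (f , f-decreasing) =
    noBadSequence f λ i<j fi≤Pfj → <⇒≱ antisym (f-descends i<j) (extends _ _ fi≤Pfj)
    where
    open IsLinearisation lin
    open IsTotalOrder isTotalOrder using (antisym) renaming (isPartialOrder to ⊑-isPartialOrder)
    open NonStrictToStrict _≡_ _⊑_ using (<⇒≱; <-trans)
    f-descends : ∀ {i j} → i ℕ.< j → _<_ _⊑_ (f j) (f i)
    f-descends = transitive-chain {R = λ a b → _<_ _⊑_ b a}
      (λ b<a c<b → <-trans ⊑-isPartialOrder c<b b<a) f-decreasing

module WellOrder (em : ExcludedMiddle 0ℓ) {A : Set} {_⊑_ : A → A → Set}
  (isTotalOrder : IsTotalOrder _≡_ _⊑_)
  (wellFounded : ¬ Σ (ℕ → A) (StrictlyDecreasing _⊑_)) where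

  open IsTotalOrder isTotalOrder
    using (total; antisym; isPartialOrder; reflexive) renaming (refl to ⊑-refl; trans to ⊑-trans)
  open NonStrictToStrict _≡_ _⊑_ using (≤-<-trans; ≰⇒>)
  private dne = em⇒dne em

  infix 4 _⊏_
  _⊏_ : A → A → Set
  _⊏_ = _<_ _⊑_

  ⊏-trans : Transitive _⊏_
  ⊏-trans = NonStrictToStrict.<-trans _≡_ _⊑_ isPartialOrder

  ⊑-⊏-trans : ∀ {a b c} → a ⊑ b → b ⊏ c → a ⊏ c
  ⊑-⊏-trans = ≤-<-trans ⊑-trans antisym (respˡ _⊑_)

  ⋢⇒⊐ : ∀ {a b} → ¬ (a ⊑ b) → b ⊏ a
  ⋢⇒⊐ = ≰⇒> sym reflexive total

  Least Greatest : (A → Set) → A → Set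
  Least Q a = Q a × ∀ b → Q b → a ⊑ b
  Greatest Q a = Q a × ∀ b → Q b → b ⊑ a

  infiniteDescent : ∀ {Q : A → Set} → (∀ {a} → Q a → Σ A λ b → Q b × b ⊏ a) → ¬ Σ A Q
  infiniteDescent smaller inhabited =
    let s , _ , s-step = dependentChoice (λ a b → b ⊏ a) smaller inhabited in wellFounded (s , s-step)

  least : ∀ {Q} → Σ A Q → Σ A (Least Q)
  least {Q} inhabited = dne λ noLeast → infiniteDescent (smaller noLeast) inhabited
    where
    smaller : ¬ Σ A (Least Q) → ∀ {a} → Q a → Σ A λ b → Q b × b ⊏ a
    smaller noLeast {a} qa = dne λ noSmaller →
      noLeast (a , qa , λ b qb → dne λ a⋢b → noSmaller (b , qb , ⋢⇒⊐ a⋢b))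

  strictMono-bound∉downSet : ∀ {D : A → Set} → (∀ {a b} → a ⊑ b → D b → D a) →
    (ψ : Σ A D → A) → (∀ {p q} → proj₁ p ⊏ proj₁ q → ψ p ⊏ ψ q) →
    ∀ {b} → (∀ p → ψ p ⊏ b) → ¬ D b
  strictMono-bound∉downSet {D} D-downClosed ψ ψ-mono {b} bound b∈D =
    infiniteDescent next (b , b∈D , bound (b , b∈D))
    where
    MovedDown : A → Set
    MovedDown a = Σ (D a) λ a∈D → ψ (a , a∈D) ⊏ a
    next : ∀ {a} → MovedDown a → Σ A λ c → MovedDown c × c ⊏ a
    next {a} (a∈D , ψa⊏a) = ψ (a , a∈D) , (D-downClosed (proj₁ (bound _)) b∈D , ψ-mono ψa⊏a) , ψa⊏a

  Outside : ∀ {n} → (Fin n → A) → A → Set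
  Outside g a = ∀ i → g i ≢ a

  ImageUpClosed : ∀ {n} → (Fin n → A) → Set
  ImageUpClosed g = ∀ i a → g i ⊑ a → ∃ λ j → g j ≡ a

  ¬outside⇒∈image : ∀ {n} {g : Fin n → A} {a} → ¬ Outside g a → ∃ λ i → g i ≡ a
  ¬outside⇒∈image notOutside = dne λ notInImage → notOutside λ i gi≡a → notInImage (i , gi≡a)

  module _ {n} {g : Fin n → A} (g-upClosed : ImageUpClosed g) where

    outside-downClosed : ∀ {a b} → a ⊑ b → Outside g b → Outside g a
    outside-downClosed a⊑b b-outside i refl =
      let j , gj≡b = g-upClosed i _ a⊑b in b-outside j gj≡b

    outside⊏image : ∀ {a} → Outside g a → ∀ i → a ⊏ g i
    outside⊏image {a} a-outside i with total a (g i)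
    ... | inj₁ a⊑gi = a⊑gi , λ a≡gi → a-outside i (sym a≡gi)
    ... | inj₂ gi⊑a = let j , gj≡a = g-upClosed i a gi⊑a in ⊥-elim (a-outside j gj≡a)

    ∷-upClosed : ∀ {a} → Greatest (Outside g) a → ImageUpClosed (a ∷ g)
    ∷-upClosed _ (suc i) b gi⊑b = let j , gj≡b = g-upClosed i b gi⊑b in suc j , gj≡b
    ∷-upClosed {a} (_ , a-greatest) zero b a⊑b with em {∃ λ j → g j ≡ b}
    ... | yes (j , gj≡b) = suc j , gj≡b
    ... | no b∉g = zero , antisym a⊑b (a-greatest b λ j gj≡b → b∉g (j , gj≡b))

  ∷-injective : ∀ {n} {g : Fin n → A} {a} → (∀ i j → g i ≡ g j → i ≡ j) → Outside g a →
    ∀ i j → (a ∷ g) i ≡ (a ∷ g) j → i ≡ j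
  ∷-injective g-injective a-outside zero zero _ = refl
  ∷-injective g-injective a-outside zero (suc j) a≡gj = ⊥-elim (a-outside j (sym a≡gj))
  ∷-injective g-injective a-outside (suc i) zero gi≡a = ⊥-elim (a-outside i gi≡a)
  ∷-injective g-injective a-outside (suc i) (suc j) gi≡gj = cong suc (g-injective i j gi≡gj)

  limitPlus-exists : ∃ (IsLimitPlus _⊑_)
  limitPlus-exists = dne λ noLimitPlus → infiniteDescent (next noLimitPlus) (start noLimitPlus)
    where
    GreatestBelowFinalSegment : A → Set
    GreatestBelowFinalSegment a = Σ ℕ λ n → Σ (Fin n → A) λ g →
      (∀ i j → g i ≡ g j → i ≡ j) × ImageUpClosed g × Greatest (Outside g) a

    module _ (noLimitPlus : ¬ ∃ (IsLimitPlus _⊑_)) where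
      greatestOutside : ∀ {n} {g : Fin n → A} → (∀ i j → g i ≡ g j → i ≡ j) → ImageUpClosed g →
        Σ A (Greatest (Outside g))
      greatestOutside g-injective g-upClosed =
        dne λ noGreatest → noLimitPlus (_ , _ , g-injective , g-upClosed , noGreatest)

      start : Σ A GreatestBelowFinalSegment
      start = let a , a-greatest = greatestOutside {g = []} (λ ()) (λ ())
              in a , 0 , [] , (λ ()) , (λ ()) , a-greatest

      next : ∀ {a} → GreatestBelowFinalSegment a → Σ A λ b → GreatestBelowFinalSegment b × b ⊏ a
      next {a} (n , g , g-injective , g-upClosed , a-outside , a-greatest) =
        let a∷g-injective = ∷-injective g-injective a-outside
            a∷g-upClosed = ∷-upClosed g-upClosed (a-outside , a-greatest)
            b , b-outside , b-greatest = greatestOutside a∷g-injective a∷g-upClosed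
        in b , (suc n , a ∷ g , a∷g-injective , a∷g-upClosed , b-outside , b-greatest) ,
           a-greatest b (b-outside ∘ suc) , λ b≡a → b-outside zero (sym b≡a)

  finite-greatest : ∀ {n} (g : Fin (suc n) → A) → Σ (Fin (suc n)) λ i → ∀ j → g j ⊑ g i
  finite-greatest {zero} g = zero , λ { zero → ⊑-refl }
  finite-greatest {suc n} g with finite-greatest (g ∘ suc)
  ... | i , greatest with total (g zero) (g (suc i))
  ...   | inj₁ g0⊑gi = suc i , λ { zero → g0⊑gi ; (suc j) → greatest j }
  ...   | inj₂ gi⊑g0 = zero , λ { zero → ⊑-refl ; (suc j) → ⊑-trans (greatest j) gi⊑g0 }

  nonemptyFinalSegment-maximum : ∀ {n} {g : Fin (suc n) → A} → ImageUpClosed g →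
    Σ A λ a → ∀ b → b ⊑ a
  nonemptyFinalSegment-maximum {g = g} g-upClosed with i , gi-greatest ← finite-greatest g
    = g i , below
    where
    below : ∀ b → b ⊑ g i
    below b with total b (g i)
    ... | inj₁ b⊑gi = b⊑gi
    ... | inj₂ gi⊑b = let j , gj≡b = g-upClosed i b gi⊑b in subst (_⊑ g i) gj≡b (gi-greatest j)

  module _ {m} {g : Fin m → A} (g-upClosed : ImageUpClosed g)
    (noGreatest : ¬ Σ A (Greatest (Outside g))) where

    successor : ∀ {d} → Outside g d → Σ A λ s → Outside g s × Least (d ⊏_) s
    successor {d} d-outside =
      let e , e-outside , d⊏e = above
          s , d⊏s , s-least = least (e , d⊏e)
      in s , outside-downClosed g-upClosed (s-least e d⊏e) e-outside , d⊏s , s-least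
      where
      above : Σ A λ e → Outside g e × d ⊏ e
      above = dne λ noneAbove → noGreatest (d , d-outside , λ b b-outside →
        dne λ b⋢d → noneAbove (b , b-outside , ⋢⇒⊐ b⋢d))

    skip : A → Σ A (Outside g) → A
    skip x (d , d-outside) with em {x ⊑ d}
    ... | yes _ = proj₁ (successor d-outside)
    ... | no _ = d

    skip-outside : ∀ x p → Outside g (skip x p)
    skip-outside x (d , d-outside) with em {x ⊑ d}
    ... | yes _ = proj₁ (proj₂ (successor d-outside))
    ... | no _ = d-outside

    skip-≢ : ∀ x p → skip x p ≢ x
    skip-≢ x (d , d-outside) with em {x ⊑ d}
    ... | yes x⊑d = let _ , _ , d⊏s , _ = successor d-outside in λ s≡x → proj₂ (⊑-⊏-trans x⊑d d⊏s) (sym s≡x)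
    ... | no x⋢d = λ { refl → x⋢d ⊑-refl }

    skip-mono : ∀ x {p q} → proj₁ p ⊏ proj₁ q → skip x p ⊏ skip x q
    skip-mono x {d , d-outside} {d′ , d′-outside} d⊏d′ with em {x ⊑ d} | em {x ⊑ d′}
    ... | yes _ | yes _ = let _ , _ , _ , s-least = successor d-outside
                              _ , _ , d′⊏s′ , _ = successor d′-outside
                          in ⊑-⊏-trans (s-least d′ d⊏d′) d′⊏s′
    ... | yes x⊑d | no x⋢d′ = ⊥-elim (x⋢d′ (⊑-trans x⊑d (proj₁ d⊏d′)))
    ... | no _ | yes _ = let _ , _ , d′⊏s′ , _ = successor d′-outside in ⊏-trans d⊏d′ d′⊏s′
    ... | no _ | no _ = d⊏d′

    moveToTop-notEmbeddable : (∀ i j → g i ≡ g j → i ≡ j) → ∀ {x} → Outside g x →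
      ¬ (moveToTop x _⊑_ ≼ _⊑_)
    moveToTop-notEmbeddable g-injective {x} x-outside embedding@(f , f-mono) =
      ℕ.1+n≰n (distinctInImage⇒≤ {h = f ∘ top} f∘top-injective f∘top∈image)
      where
      top : Fin (suc m) → A
      top = x ∷ g

      f∘top-injective : ∀ i j → f (top i) ≡ f (top j) → i ≡ j
      f∘top-injective i j = ∷-injective g-injective x-outside i j ∘ f-injective (top i) (top j)
        where
        f-injective : ∀ a b → f a ≡ f b → a ≡ b
        f-injective = strictMono⇒injective em {_⊑₂_ = _⊑_}
          (IsTotalOrder.total (moveToTop-isTotalOrder em isTotalOrder x)) embedding

      ψ : Σ A (Outside g) → A
      ψ = f ∘ skip x

      ψ-mono : ∀ {p q} → proj₁ p ⊏ proj₁ q → ψ p ⊏ ψ q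
      ψ-mono {p} p⊏q = let s⊑s′ , s≢s′ = skip-mono x p⊏q in
        f-mono _ _ (inj₂ (skip-≢ x p , s⊑s′)) s≢s′

      ψ⊏f∘top : ∀ i p → ψ p ⊏ f (top i)
      ψ⊏f∘top zero p = f-mono _ _ (inj₁ refl) (skip-≢ x p)
      ψ⊏f∘top (suc i) p = let s⊑gi , s≢gi = outside⊏image g-upClosed (skip-outside x p) i in
        f-mono _ _ (inj₂ (skip-≢ x p , s⊑gi)) s≢gi

      f∘top∈image : ∀ i → ∃ λ j → g j ≡ f (top i)
      f∘top∈image i = ¬outside⇒∈image
        (strictMono-bound∉downSet (outside-downClosed g-upClosed) ψ ψ-mono (ψ⊏f∘top i))

module MaximalLinearisation (em : ExcludedMiddle 0ℓ) {A : Set} {_≤P_ _⊑_ : A → A → Set}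
  (wpo : IsWPO _≤P_) (maxLin : IsMaxLinearisation _≤P_ _⊑_) where

  open IsLinearisation (proj₁ maxLin)
  open IsTotalOrder isTotalOrder using (antisym)
  open WellOrder em isTotalOrder (linearisation-wellFounded em wpo (proj₁ maxLin)) public

  maximum⇒maximal : ∀ {a} → (∀ b → b ⊑ a) → Maximal _≤P_ a
  maximum⇒maximal a-maximum b a≤Pb = antisym (a-maximum b) (extends _ b a≤Pb)

  maximal∈finalSegment : ∀ {m} {g : Fin m → A} → (∀ i j → g i ≡ g j → i ≡ j) → ImageUpClosed g →
    ¬ Σ A (Greatest (Outside g)) → ∀ {x} → Maximal _≤P_ x → ∃ λ j → g j ≡ x
  maximal∈finalSegment g-injective g-upClosed noGreatest x-maximal = ¬outside⇒∈image λ x-outside →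
    moveToTop-notEmbeddable g-upClosed noGreatest g-injective x-outside
      (proj₂ maxLin _ (moveToTop-isLinearisation em (proj₁ maxLin) x-maximal))

  maximalCount≤ : ∀ {k m} → HasExactly k (Maximal _≤P_) → IsLimitPlus _⊑_ m → k ≤ m
  maximalCount≤ (h , h-injective , h-maximal , _) (g , g-injective , g-upClosed , noGreatest) =
    distinctInImage⇒≤ h-injective λ i → maximal∈finalSegment g-injective g-upClosed noGreatest (h-maximal i)

  noMaximal⇒finalSegment≡0 : ∀ {m} → HasExactly 0 (Maximal _≤P_) → IsLimitPlus _⊑_ m → m ≡ 0
  noMaximal⇒finalSegment≡0 {zero} _ _ = refl
  noMaximal⇒finalSegment≡0 {suc m} (_ , _ , _ , maximal∈h) (_ , _ , g-upClosed , _) =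
    let a , a-maximum = nonemptyFinalSegment-maximum g-upClosed in
    ⊥-elim (¬Fin0 (proj₁ (maximal∈h a (maximum⇒maximal a-maximum))))

claim2p6 : (∀ {ℓ : Level} → ExcludedMiddle ℓ) →
    {A : Set} (_≤P_ : A → A → Set) → IsWPO _≤P_ →
    (k : ℕ) → HasExactly k (Maximal _≤P_) →
    (_⊑_ : A → A → Set) → IsMaxLinearisation _≤P_ _⊑_ →
    ∃ λ m → IsLimitPlus _⊑_ m × k ≤ m × ((k ≡ 0) ⇔ (m ≡ 0))
claim2p6 em _≤P_ wpo k maximals _⊑_ maxLin =
  let m , limitPlus = limitPlus-exists
      k≤m = maximalCount≤ maximals limitPlus
  in m , limitPlus , k≤m ,
     mk⇔ (λ { refl → noMaximal⇒finalSegment≡0 maximals limitPlus })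
         (λ m≡0 → n≤0⇒n≡0 (subst (k ≤_) m≡0 k≤m))
  where open MaximalLinearisation em wpo maxLin
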